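{- For all $n\ge1$ and $k$, the number $b(n,k)$ of Bell permutations of the second kind in $\mathfrak{S}_n$ having exactly $k$ weak exceedances equals the Stirling number of the second kind $S(n,k)$.
   Context: $\mathfrak{S}_n$ is the symmetric group on $[n]$. A weak exceedance of $\sigma$ is a position $i$ with $\sigma(i)\ge i$. For $\sigma\in\mathfrak{S}_n$ and $i\in[n]$, $\mathrm{inom}(i)=\sigma^{ -t}(i)$ where $t\ge1$ is the smallest positive integer with $\sigma^{ -t}(i)\le i$. The inom code of $\sigma$ is $f=f_1\cdots f_n$ with $f_i=\mathrm{inom}(i)$ (equivalently the unique subexceedant function with $\sigma=(n\ f_n)\cdots(1\ f_1)$, leftmost transposition acting first). $\sigma$ is a Bell permutation of the second kind if its inom code satisfies: for every $i\in[n]$, $\{f_1,\dots,f_i\}$ is an integer interval. $S(n,k)$ is the number of set partitions of $[n]$ into $k$ blocks. -}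

module Defs where

open import Data.Bool using (Bool; true; false; _∧_; _∨_; not; if_then_else_)
open import Data.Nat using (ℕ; zero; suc; _≤ᵇ_; _≡ᵇ_; _<ᵇ_)
open import Data.Fin using (Fin; toℕ)
open import Data.Vec using (Vec; []; _∷_; lookup; toList)
open import Data.List using (List; []; _∷_; map; concatMap; length; filterᵇ; allFin)
open import Data.Bool.ListAction using (all; any)

-- The ground set [n] = {1,…,n} is modelled by Fin n = {0,…,n-1}
-- (the shift i ↦ i+1 preserves the order, which is all that matters).

_=ᶠ_ : ∀ {n} → Fin n → Fin n → Bool
a =ᶠ b = toℕ a ≡ᵇ toℕ b

_≤ᶠ_ : ∀ {n} → Fin n → Fin n → Bool
a ≤ᶠ b = toℕ a ≤ᵇ toℕ b

allVecs : ∀ {A : Set} → List A → (m : ℕ) → List (Vec A m)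
allVecs xs zero    = [] ∷ []
allVecs xs (suc m) = concatMap (λ x → map (x ∷_) (allVecs xs m)) xs

count : ∀ {A : Set} → (A → Bool) → List A → ℕ
count p xs = length (filterᵇ p xs)

-- Permutations of [n], as their one-line notation σ(1)…σ(n)

isPerm : ∀ {n} → Vec (Fin n) n → Bool
isPerm {n} σ = all (λ i → all (λ j → (i =ᶠ j) ∨ not (lookup σ i =ᶠ lookup σ j))
                              (allFin n)) (allFin n)

firstWith : ∀ {n} → (Fin n → Bool) → Fin n → List (Fin n) → Fin n
firstWith p d []       = d
firstWith p d (j ∷ js) = if p j then j else firstWith p d js

σinv : ∀ {n} → Vec (Fin n) n → Fin n → Fin n
σinv {n} σ i = firstWith (λ j → lookup σ j =ᶠ i) i (allFin n)

-- inom(i) = σ^{-t}(i), t ≥ 1 least with σ^{-t}(i) ≤ i.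
-- Search along the backward orbit of i; t ≤ (cycle length) ≤ n, so fuel n
-- suffices (at t = cycle length one gets i itself ≤ i).
inomFuel : ∀ {n} → ℕ → Vec (Fin n) n → Fin n → Fin n → Fin n
inomFuel zero     σ i x = i
inomFuel (suc fu) σ i x = if (σinv σ x ≤ᶠ i) then σinv σ x else inomFuel fu σ i (σinv σ x)

inom : ∀ {n} → Vec (Fin n) n → Fin n → Fin n
inom {n} σ i = inomFuel n σ i i

inomCode : ∀ {n} → Vec (Fin n) n → Fin n → Fin n
inomCode σ = inom σ

isInterval : ∀ {n} → List (Fin n) → Bool
isInterval {n} S =
  any (λ _ → true) S ∧
  all (λ v → not (any (λ a → a ≤ᶠ v) S ∧ any (λ b → v ≤ᶠ b) S) ∨ any (λ a → a =ᶠ v) S)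
      (allFin n)

prefixSet : ∀ {n} → (Fin n → Fin n) → Fin n → List (Fin n)
prefixSet {n} f i = map f (filterᵇ (λ j → j ≤ᶠ i) (allFin n))

isBell2 : ∀ {n} → Vec (Fin n) n → Bool
isBell2 {n} σ = all (λ i → isInterval (prefixSet (inomCode σ) i)) (allFin n)

wex : ∀ {n} → Vec (Fin n) n → ℕ
wex {n} σ = count (λ i → i ≤ᶠ lookup σ i) (allFin n)

bellCount2 : ℕ → ℕ → ℕ
bellCount2 n k = count (λ σ → isPerm σ ∧ isBell2 σ ∧ (wex σ ≡ᵇ k))
                       (allVecs (allFin n) n)

-- A block is a subset of [n] (characteristic vector Vec Bool n).
-- The (unordered) set of k blocks is represented canonically by listing
-- the blocks in increasing order of their minimal elements.

allSubsets : (n : ℕ) → List (Vec Bool n)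
allSubsets n = allVecs (true ∷ false ∷ []) n

-- index of the least element of a subset (n if empty)
minElem : ∀ {n} → Vec Bool n → ℕ
minElem []           = 0
minElem (true  ∷ bs) = 0
minElem (false ∷ bs) = suc (minElem bs)

strictlyIncreasing : List ℕ → Bool
strictlyIncreasing []           = true
strictlyIncreasing (a ∷ [])     = true
strictlyIncreasing (a ∷ b ∷ xs) = (a <ᵇ b) ∧ strictlyIncreasing (b ∷ xs)

nonemptyB : ∀ {n} → Vec Bool n → Bool
nonemptyB {n} B = any (λ x → lookup B x) (allFin n)

isSetPartition : ∀ {n k} → Vec (Vec Bool n) k → Bool
isSetPartition {n} P =
  all nonemptyB (toList P) ∧
  all (λ x → count (λ B → lookup B x) (toList P) ≡ᵇ 1) (allFin n) ∧
  strictlyIncreasing (map minElem (toList P))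

stirling2 : ℕ → ℕ → ℕ
stirling2 n k = count isSetPartition (allVecs (allSubsets n) k)

-- Following the backward orbit of i until it first returns to [1,i] gives inom(i), and
-- σ = (n fₙ) ⋯ (1 f₁): the inom code is a bijection from 𝔖ₙ onto the subexceedant
-- functions (fᵢ ≤ i).  Since inom(σ(j)) = j exactly when σ(j) ≥ j, the weak exceedances
-- of σ are the values of its code.  For a subexceedant f we have f₁ = 1, so every
-- {f₁,…,fᵢ} is an interval iff it is an initial segment of [n]; then f is the
-- restricted growth function of a set partition (fᵢ is the index of the block of i
-- when blocks are ordered by their minima) whose number of blocks is the number of
-- values of f.  Hence both b(n,k) and S(n,k) count these codes with k values.

module Submission where

open import Data.Bool using (Bool; true; false; T; T?; not; _∧_; _∨_; if_then_else_)
open import Data.Bool.Properties using (T-∧; T-∨; T-≡; T-not-≡)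
open import Data.Bool.ListAction using (all; any; and)
open import Data.Empty using (⊥-elim)
open import Data.Fin using (Fin; toℕ; fromℕ<)
import Data.Fin as Fin
import Data.Fin.Properties as Fin
open import Data.List
  using (List; []; _∷_; length; map; filterᵇ; allFin; concatMap; cartesianProductWith; _++_)
import Data.List as List
open import Data.List.Properties
  using (length-map; length-filter; length-tabulate; map-cong; map-tabulate; map-∘; map-id-local;
         filter-≐; filter-none)
open import Data.List.Membership.Propositional using (_∈_; find; lose)
open import Data.List.Membership.Propositional.Properties
  using (∈-allFin; ∈-filter⁺; ∈-filter⁻; ∈-map⁺; ∈-map⁻; ∈-tabulate⁺; ∈-tabulate⁻;
         ∈-cartesianProductWith⁺)
open import Data.List.Membership.Propositional.Properties.WithK using (unique∧set⇒bag)
open import Data.List.Relation.Binary.BagAndSetEquality using (∼bag⇒↭)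
open import Data.List.Relation.Binary.Permutation.Propositional.Properties using (↭-length)
open import Data.List.Relation.Unary.All as All using (All)
open import Data.List.Relation.Unary.All.Properties using (all⁺; all⁻)
open import Data.List.Relation.Unary.Any using (here; there)
open import Data.List.Relation.Unary.Any.Properties using (any⁺; any⁻)
open import Data.List.Relation.Unary.Unique.Propositional using (Unique; []; _∷_)
import Data.List.Relation.Unary.Unique.Propositional.Properties as Unique
open import Data.Nat
  using (ℕ; zero; suc; _+_; _∸_; _⊓_; _≤_; _<_; z≤n; s≤s; z<s; _≤ᵇ_; _<ᵇ_; _≡ᵇ_; _≟_; _≤?_; _<?_)
open import Data.Nat.Properties
open import Data.Product using (Σ; ∃; _×_; _,_; proj₁; proj₂)
open import Data.Sum using (inj₁; inj₂)
open import Data.Vec using (Vec; []; _∷_; lookup; tabulate; toList)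
open import Data.Vec.Properties using (lookup∘tabulate; tabulate∘lookup; tabulate-cong; ∷-injective)
open import Function using (id; _∘_; _⇔_; mk⇔; Equivalence)
open import Relation.Nullary using (¬_; yes; no)
open import Relation.Binary.PropositionalEquality

open import Defs

private
  variable
    A B : Set

-- Boolean reflection and counting

¬T⇒≡false : ∀ {b} → ¬ T b → b ≡ false
¬T⇒≡false {false} _  = refl
¬T⇒≡false {true}  ¬t = ⊥-elim (¬t _)

T-injective : ∀ {a b} → (T a → T b) → (T b → T a) → a ≡ b
T-injective {false} {false} _ _ = refl
T-injective {false} {true}  _ b⇒a = ⊥-elim (b⇒a _)
T-injective {true}  {false} a⇒b _ = ⊥-elim (a⇒b _)
T-injective {true}  {true}  _ _ = refl

∧⁻ : ∀ {a b} → T (a ∧ b) → T a × T b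
∧⁻ = Equivalence.to T-∧

∧⁺ : ∀ {a b} → T a → T b → T (a ∧ b)
∧⁺ ta tb = Equivalence.from T-∧ (ta , tb)

T-implication⁻ : ∀ {x y z} → T x → T y → T (not (x ∧ y) ∨ z) → T z
T-implication⁻ {true} {true} _ _ tz = tz

T-implication⁺ : ∀ {x y z} → (T x → T y → T z) → T (not (x ∧ y) ∨ z)
T-implication⁺ {true}  {true}  f = f _ _
T-implication⁺ {true}  {false} f = _
T-implication⁺ {false}         f = _

all-∈⁻ : ∀ (p : A → Bool) {xs x} → T (all p xs) → x ∈ xs → T (p x)
all-∈⁻ p {xs} h = All.lookup (all⁺ p xs h)

all-∈⁺ : ∀ (p : A → Bool) xs → (∀ {x} → x ∈ xs → T (p x)) → T (all p xs)
all-∈⁺ p xs h = all⁻ p (All.tabulate h)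

any-∈⁺ : ∀ (p : A → Bool) {xs x} → x ∈ xs → T (p x) → T (any p xs)
any-∈⁺ p x∈xs px = any⁺ p (lose x∈xs px)

any-∈⁻ : ∀ (p : A → Bool) xs → T (any p xs) → ∃ λ x → x ∈ xs × T (p x)
any-∈⁻ p xs h = find (any⁻ p xs h)

∀-Fin⇒∀-< : ∀ {n} {P : ℕ → Set} → (∀ (i : Fin n) → P (toℕ i)) → ∀ {i} → i < n → P i
∀-Fin⇒∀-< {P = P} h i<n = subst P (Fin.toℕ-fromℕ< i<n) (h (fromℕ< i<n))

lookup-extensional : ∀ {n} {u v : Vec A n} → (∀ i → lookup u i ≡ lookup v i) → u ≡ v
lookup-extensional {u = u} {v} u≗v =
  trans (sym (tabulate∘lookup u)) (trans (tabulate-cong u≗v) (tabulate∘lookup v))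

toList≡tabulate : ∀ {k} (v : Vec A k) → toList v ≡ List.tabulate (lookup v)
toList≡tabulate []      = refl
toList≡tabulate (x ∷ v) = cong (x ∷_) (toList≡tabulate v)

∈-filterᵇ⁺ : ∀ (p : A → Bool) {xs x} → x ∈ xs → T (p x) → x ∈ filterᵇ p xs
∈-filterᵇ⁺ p = ∈-filter⁺ (T? ∘ p)

∈-filterᵇ⁻ : ∀ (p : A → Bool) xs {x} → x ∈ filterᵇ p xs → x ∈ xs × T (p x)
∈-filterᵇ⁻ p xs = ∈-filter⁻ (T? ∘ p) {xs = xs}

filterᵇ⁺ : ∀ (p : A → Bool) {xs} → Unique xs → Unique (filterᵇ p xs)
filterᵇ⁺ p = Unique.filter⁺ (T? ∘ p)

count-≤-length : ∀ (p : A → Bool) xs → count p xs ≤ length xs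
count-≤-length p = length-filter (T? ∘ p)

count-cong : ∀ (p q : A → Bool) → (∀ x → T (p x) → T (q x)) → (∀ x → T (q x) → T (p x)) →
             ∀ xs → count p xs ≡ count q xs
count-cong p q p⇒q q⇒p xs =
  cong length (filter-≐ (T? ∘ p) (T? ∘ q) ((λ {x} → p⇒q x) , (λ {x} → q⇒p x)) xs)

count-none : ∀ (p : A → Bool) xs → (∀ x → ¬ T (p x)) → count p xs ≡ 0
count-none p xs ¬p = cong length (filter-none (T? ∘ p) {xs = xs} (All.tabulate λ {x} _ → ¬p x))

count-tabulate : ∀ {n} (p : A → Bool) (f : Fin n → A) →
                 count p (List.tabulate f) ≡ count (p ∘ f) (allFin n)
count-tabulate {n = zero}  p f = refl
count-tabulate {n = suc n} p f with p (f Fin.zero)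
... | true  = cong suc tail≡
  where tail≡ = trans (count-tabulate p (f ∘ Fin.suc)) (sym (count-tabulate (p ∘ f) Fin.suc))
... | false = trans (count-tabulate p (f ∘ Fin.suc)) (sym (count-tabulate (p ∘ f) Fin.suc))

unique-set⇒length≡ : ∀ {xs ys : List A} → Unique xs → Unique ys →
                     (∀ {x} → x ∈ xs ⇔ x ∈ ys) → length xs ≡ length ys
unique-set⇒length≡ xs! ys! xs≈ys = ↭-length (∼bag⇒↭ (unique∧set⇒bag xs! ys! xs≈ys))

count≡1⇒∃! : ∀ (p : A → Bool) xs → count p xs ≡ 1 →
             ∃ λ z → z ∈ xs × T (p z) × (∀ {x} → x ∈ xs → T (p x) → x ≡ z)
count≡1⇒∃! p xs c≡1 with filterᵇ p xs in eq
count≡1⇒∃! p xs ()  | []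
count≡1⇒∃! p xs ()  | _ ∷ _ ∷ _
count≡1⇒∃! p xs c≡1 | z ∷ [] = z , z∈xs×pz .proj₁ , z∈xs×pz .proj₂ , unique
  where
  z∈xs×pz : z ∈ xs × T (p z)
  z∈xs×pz = ∈-filterᵇ⁻ p xs (subst (z ∈_) (sym eq) (here refl))
  unique : ∀ {x} → x ∈ xs → T (p x) → x ≡ z
  unique x∈xs px with subst (_ ∈_) eq (∈-filterᵇ⁺ p x∈xs px)
  ... | here x≡z = x≡z

∃!⇒count≡1 : ∀ (p : A → Bool) {xs z} → Unique xs → z ∈ xs → T (p z) →
             (∀ {x} → x ∈ xs → T (p x) → x ≡ z) → count p xs ≡ 1
∃!⇒count≡1 p {xs} {z} xs! z∈xs pz unique =
  unique-set⇒length≡ (filterᵇ⁺ p xs!) (All.[] ∷ []) (mk⇔ ⊆z ⊇z)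
  where
  ⊆z : ∀ {x} → x ∈ filterᵇ p xs → x ∈ z ∷ []
  ⊆z x∈ = let x∈xs , px = ∈-filterᵇ⁻ p xs x∈ in here (unique x∈xs px)
  ⊇z : ∀ {x} → x ∈ z ∷ [] → x ∈ filterᵇ p xs
  ⊇z (here refl) = ∈-filterᵇ⁺ p z∈xs pz

IsEnumeration : List A → Set
IsEnumeration xs = Unique xs × (∀ a → a ∈ xs)

record BijectionBetween (p : A → Bool) (q : B → Bool) : Set where
  field
    to       : A → B
    from     : B → A
    to-q     : ∀ {a} → T (p a) → T (q (to a))
    from-p   : ∀ {b} → T (q b) → T (p (from b))
    from∘to  : ∀ {a} → T (p a) → from (to a) ≡ a
    to∘from  : ∀ {b} → T (q b) → to (from b) ≡ b

count-bijection : ∀ {p : A → Bool} {q : B → Bool} {xs ys} →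
                  IsEnumeration xs → IsEnumeration ys → BijectionBetween p q →
                  count p xs ≡ count q ys
count-bijection {p = p} {q} {xs} {ys} (xs! , xs-all) (ys! , ys-all) bij = begin
  count p xs                     ≡⟨ length-map to ps ⟨
  length (map to ps)             ≡⟨ unique-set⇒length≡ to-ps! (filterᵇ⁺ q ys!) (mk⇔ ⊆qs ⊇qs) ⟩
  count q ys                     ∎
  where
  open BijectionBetween bij
  open ≡-Reasoning
  ps = filterᵇ p xs

  -- `from` undoes `to` on ps, so duplicates in `map to ps` would be duplicates in ps
  to-ps! : Unique (map to ps)
  to-ps! = Unique.map⁻ (subst Unique (sym from∘to-ps) (filterᵇ⁺ p xs!))
    where
    from∘to-ps : map from (map to ps) ≡ ps
    from∘to-ps = trans (sym (map-∘ ps))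
                       (map-id-local (All.tabulate (from∘to ∘ proj₂ ∘ ∈-filterᵇ⁻ p xs)))

  ⊆qs : ∀ {b} → b ∈ map to ps → b ∈ filterᵇ q ys
  ⊆qs b∈ with a , a∈ , refl ← ∈-map⁻ to b∈ =
    ∈-filterᵇ⁺ q (ys-all _) (to-q (proj₂ (∈-filterᵇ⁻ p xs a∈)))

  ⊇qs : ∀ {b} → b ∈ filterᵇ q ys → b ∈ map to ps
  ⊇qs b∈ = subst (_∈ map to ps) (to∘from qb) (∈-map⁺ to (∈-filterᵇ⁺ p (xs-all _) (from-p qb)))
    where qb = proj₂ (∈-filterᵇ⁻ q ys b∈)

allVecs-suc : ∀ (xs : List A) m → allVecs xs (suc m) ≡ cartesianProductWith _∷_ xs (allVecs xs m)
allVecs-suc xs m = prepend-each xs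
  where
  prepend-each : ∀ zs → concatMap (λ z → map (z ∷_) (allVecs xs m)) zs
                        ≡ cartesianProductWith _∷_ zs (allVecs xs m)
  prepend-each []       = refl
  prepend-each (z ∷ zs) = cong (map (z ∷_) (allVecs xs m) ++_) (prepend-each zs)

allVecs-enumeration : ∀ {xs : List A} → IsEnumeration xs → ∀ m → IsEnumeration (allVecs xs m)
allVecs-enumeration _ zero = All.[] ∷ [] , λ { [] → here refl }
allVecs-enumeration {xs = xs} (xs! , xs-all) (suc m) =
  subst IsEnumeration (sym (allVecs-suc xs m))
        ( Unique.cartesianProductWith⁺ _∷_ ∷-injective xs! vs!
        , λ { (a ∷ v) → ∈-cartesianProductWith⁺ _∷_ (xs-all a) (vs-all v) })
  where
  vs! = proj₁ (allVecs-enumeration (xs! , xs-all) m)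
  vs-all = proj₂ (allVecs-enumeration (xs! , xs-all) m)

count-initialSegment : ∀ n k → k ≤ n → count (λ (v : Fin n) → toℕ v <ᵇ k) (allFin n) ≡ k
count-initialSegment n       zero    _         =
  count-none (λ (v : Fin n) → toℕ v <ᵇ 0) (allFin n) (λ _ ())
count-initialSegment (suc n) (suc k) (s≤s k≤n) =
  cong suc (trans (count-tabulate (λ (v : Fin (suc n)) → toℕ v <ᵇ suc k) Fin.suc)
                  (count-initialSegment n k k≤n))

DownClosed : ∀ {n} → (Fin n → Bool) → Set
DownClosed d = ∀ {v w} → toℕ w ≤ toℕ v → T (d v) → T (d w)

downClosed⇒initialSegment : ∀ {n} (d : Fin n → Bool) → DownClosed d →
                            ∀ v → d v ≡ (toℕ v <ᵇ count d (allFin n))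
downClosed⇒initialSegment {suc n} d d↓ v with d Fin.zero in d0
... | true = shift v
  where
  shift : ∀ v → d v ≡ (toℕ v <ᵇ suc (count d (List.tabulate Fin.suc)))
  shift Fin.zero    = d0
  shift (Fin.suc w) = trans (downClosed⇒initialSegment (d ∘ Fin.suc) (d↓ ∘ s≤s) w)
                            (cong (λ c → suc (toℕ w) <ᵇ suc c) (sym (count-tabulate d Fin.suc)))
... | false = trans (¬T⇒≡false (¬d v))
                    (cong (toℕ v <ᵇ_) (sym (count-none d (List.tabulate Fin.suc) ¬d)))
  where
  ¬d : ∀ w → ¬ T (d w)
  ¬d w dw = subst T d0 (d↓ z≤n dw)

-- Permutations of ℕ fixing all points ≥ N

τ : ℕ → ℕ → ℕ → ℕ
τ m c y with y ≟ m
... | yes _ = c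
... | no _ with y ≟ c
...   | yes _ = m
...   | no _  = y

τ-left : ∀ m c → τ m c m ≡ c
τ-left m c with m ≟ m
... | yes _  = refl
... | no m≢m = ⊥-elim (m≢m refl)

τ-right : ∀ m c → τ m c c ≡ m
τ-right m c with c ≟ m
... | yes c≡m = c≡m
... | no _ with c ≟ c
...   | yes _  = refl
...   | no c≢c = ⊥-elim (c≢c refl)

τ-fix : ∀ {m c y} → y ≢ m → y ≢ c → τ m c y ≡ y
τ-fix {m} {c} {y} y≢m y≢c with y ≟ m
... | yes y≡m = ⊥-elim (y≢m y≡m)
... | no _ with y ≟ c
...   | yes y≡c = ⊥-elim (y≢c y≡c)
...   | no _    = refl

τ-fix-above : ∀ {m c y} → c ≤ m → m < y → τ m c y ≡ y
τ-fix-above c≤m m<y = τ-fix (>⇒≢ m<y) (>⇒≢ (≤-<-trans c≤m m<y))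

τ-involutive : ∀ m c y → τ m c (τ m c y) ≡ y
τ-involutive m c y with y ≟ m
... | yes refl = τ-right y c
... | no y≢m with y ≟ c
...   | yes refl = τ-left m y
...   | no y≢c   = τ-fix y≢m y≢c

record PermBelow (N : ℕ) (s r : ℕ → ℕ) : Set where
  field
    s∘r   : ∀ x → s (r x) ≡ x
    r∘s   : ∀ x → r (s x) ≡ x
    s-fix : ∀ {x} → N ≤ x → s x ≡ x
    r-fix : ∀ {x} → N ≤ x → r x ≡ x

  r-injective : ∀ {x y} → r x ≡ r y → x ≡ y
  r-injective {x} {y} rx≡ry = trans (sym (s∘r x)) (trans (cong s rx≡ry) (s∘r y))

  s-injective : ∀ {x y} → s x ≡ s y → x ≡ y
  s-injective {x} {y} sx≡sy = trans (sym (r∘s x)) (trans (cong r sx≡sy) (r∘s y))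

  r-< : ∀ {x} → x < N → r x < N
  r-< {x} x<N = ≰⇒> λ N≤rx → <⇒≱ x<N (subst (N ≤_) (trans (sym (s-fix N≤rx)) (s∘r x)) N≤rx)

  s-< : ∀ {x} → x < N → s x < N
  s-< {x} x<N = ≰⇒> λ N≤sx → <⇒≱ x<N (subst (N ≤_) (trans (sym (r-fix N≤sx)) (r∘s x)) N≤sx)

open PermBelow

insert : ∀ {m c s r} → PermBelow m s r → c ≤ m → PermBelow (suc m) (s ∘ τ m c) (τ m c ∘ r)
insert {m} {c} {s} {r} P c≤m = record
  { s∘r   = λ x → trans (cong s (τ-involutive m c (r x))) (s∘r P x)
  ; r∘s   = λ x → trans (cong (τ m c) (r∘s P (τ m c x))) (τ-involutive m c x)
  ; s-fix = λ m<x → trans (cong s (τ-fix-above c≤m m<x)) (s-fix P (<⇒≤ m<x))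
  ; r-fix = λ m<x → trans (cong (τ m c) (r-fix P (<⇒≤ m<x))) (τ-fix-above c≤m m<x)
  }

-- cuts m out of its cycle; inserting (m (r m)) puts it back
delete : ∀ {m s r} → PermBelow (suc m) s r → PermBelow m (s ∘ τ m (r m)) (τ m (r m) ∘ r)
delete {m} {s} {r} P = record
  { s∘r   = λ x → trans (cong s (τ-involutive m c (r x))) (s∘r P x)
  ; r∘s   = λ x → trans (cong (τ m c) (r∘s P (τ m c x))) (τ-involutive m c x)
  ; s-fix = s-fix′
  ; r-fix = r-fix′
  }
  where
  c = r m
  c≤m : c ≤ m
  c≤m = ≤-pred (r-< P ≤-refl)
  s-fix′ : ∀ {x} → m ≤ x → s (τ m c x) ≡ x
  s-fix′ m≤x with m≤n⇒m<n∨m≡n m≤x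
  ... | inj₁ m<x  = trans (cong s (τ-fix-above c≤m m<x)) (s-fix P m<x)
  ... | inj₂ refl = trans (cong s (τ-left m c)) (s∘r P m)
  r-fix′ : ∀ {x} → m ≤ x → τ m c (r x) ≡ x
  r-fix′ m≤x with m≤n⇒m<n∨m≡n m≤x
  ... | inj₁ m<x  = trans (cong (τ m c) (r-fix P m<x)) (τ-fix-above c≤m m<x)
  ... | inj₂ refl = τ-right m c

inverse-unique : ∀ {N N′ s r s′ r′} → PermBelow N s r → PermBelow N′ s′ r′ →
                 (∀ x → s x ≡ s′ x) → ∀ x → r x ≡ r′ x
inverse-unique {s = s} {r} {s′} {r′} P P′ s≗s′ x = begin
  r x           ≡⟨ cong r (s∘r P′ x) ⟨
  r (s′ (r′ x)) ≡⟨ cong r (s≗s′ (r′ x)) ⟨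
  r (s (r′ x))  ≡⟨ r∘s P (r′ x) ⟩
  r′ x          ∎
  where open ≡-Reasoning

iterate : (ℕ → ℕ) → ℕ → ℕ → ℕ
iterate r zero    x = x
iterate r (suc t) x = iterate r t (r x)

iterate-+ : ∀ r a b x → iterate r (a + b) x ≡ iterate r b (iterate r a x)
iterate-+ r zero    b x = refl
iterate-+ r (suc a) b x = iterate-+ r a b (r x)

module _ {N s r} (P : PermBelow N s r) where

  iterate-< : ∀ t {x} → x < N → iterate r t x < N
  iterate-< zero    x<N = x<N
  iterate-< (suc t) x<N = iterate-< t (r-< P x<N)

  iterate-injective : ∀ t {x y} → iterate r t x ≡ iterate r t y → x ≡ y
  iterate-injective zero    eq = eq
  iterate-injective (suc t) eq = r-injective P (iterate-injective t eq)

  orbit : ∀ {i} → i < N → Fin (suc N) → Fin N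
  orbit i<N t = fromℕ< (iterate-< (toℕ t) i<N)

  -- pigeonhole on the N + 1 points i, r i, …, rᴺ i of [0,N)
  return-time : ∀ {i} → i < N → ∃ λ t → 1 ≤ t × t ≤ N × iterate r t i ≡ i
  return-time {i} i<N with a , b , a<b , rᵃi≡rᵇi ← Fin.pigeonhole (n<1+n N) (orbit i<N) =
    d , m<n⇒0<n∸m a<b , ≤-trans (m∸n≤m (toℕ b) (toℕ a)) (≤-pred (Fin.toℕ<n b)) ,
    iterate-injective (toℕ a) (begin
      iterate r (toℕ a) (iterate r d i) ≡⟨ iterate-+ r d (toℕ a) i ⟨
      iterate r (d + toℕ a) i           ≡⟨ cong (λ t → iterate r t i) (m∸n+n≡m (<⇒≤ a<b)) ⟩
      iterate r (toℕ b) i               ≡⟨ Fin.toℕ-fromℕ< _ ⟨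
      toℕ (orbit i<N b)                 ≡⟨ cong toℕ rᵃi≡rᵇi ⟨
      toℕ (orbit i<N a)                 ≡⟨ Fin.toℕ-fromℕ< _ ⟩
      iterate r (toℕ a) i               ∎)
    where
    open ≡-Reasoning
    d = toℕ b ∸ toℕ a

-- The inom search

-- Search r i x j: the first point ≤ i on the orbit r x, r (r x), … is j.
-- For r = σ⁻¹, inom(i) is the j with Search r i i j.
data Search (r : ℕ → ℕ) (i : ℕ) : ℕ → ℕ → Set where
  stop : ∀ {x} → r x ≤ i → Search r i x (r x)
  step : ∀ {x j} → i < r x → Search r i (r x) j → Search r i x j

stop′ : ∀ {r i x j} → r x ≡ j → j ≤ i → Search r i x j
stop′ refl = stop

step′ : ∀ {r i x y j} → r x ≡ y → i < y → Search r i y j → Search r i x j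
step′ refl = step

search-unique : ∀ {r i x j j′} → Search r i x j → Search r i x j′ → j ≡ j′
search-unique (stop _)    (stop _)    = refl
search-unique (stop rx≤i) (step i<rx _) = ⊥-elim (<⇒≱ i<rx rx≤i)
search-unique (step i<rx _) (stop rx≤i) = ⊥-elim (<⇒≱ i<rx rx≤i)
search-unique (step _ s)  (step _ s′) = search-unique s s′

search-≤ : ∀ {r i x j} → Search r i x j → j ≤ i
search-≤ (stop j≤i)  = j≤i
search-≤ (step _ s) = search-≤ s

search-cong : ∀ {r r′ i x j} → (∀ y → r y ≡ r′ y) → Search r i x j → Search r′ i x j
search-cong {x = x} r≗r′ (stop rx≤i)  = stop′ (sym (r≗r′ x)) rx≤i
search-cong {x = x} r≗r′ (step i<rx s) = step′ (sym (r≗r′ x)) i<rx (search-cong r≗r′ s)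

depth : ∀ {r i x j} → Search r i x j → ℕ
depth (stop _)   = 1
depth (step _ s) = suc (depth s)

-- In r = (m c) ∘ r′ the step x ↦ c of r′ becomes x ↦ m ↦ c, and m > i does not stop
-- a search below m.
search-insert : ∀ {m c s′ r′ r} → PermBelow m s′ r′ → (∀ x → r x ≡ τ m c (r′ x)) →
                ∀ {i x j} → i < m → x < m → Search r′ i x j → Search r i x j
search-insert {m} {c} {s′} {r′} {r} P r≡ {i} i<m = lift
  where
  r-m : r m ≡ c
  r-m = trans (r≡ m) (trans (cong (τ m c) (r-fix P ≤-refl)) (τ-left m c))
  r-detour : ∀ {x} → r′ x ≡ c → r x ≡ m
  r-detour {x} r′x≡c = trans (r≡ x) (trans (cong (τ m c) r′x≡c) (τ-right m c))
  r-direct : ∀ {x} → x < m → r′ x ≢ c → r x ≡ r′ x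
  r-direct {x} x<m r′x≢c = trans (r≡ x) (τ-fix (<⇒≢ (r-< P x<m)) r′x≢c)
  lift : ∀ {x j} → x < m → Search r′ i x j → Search r i x j
  lift {x} x<m (stop r′x≤i) with r′ x ≟ c
  ... | yes r′x≡c = step′ (r-detour r′x≡c) i<m (stop′ (trans r-m (sym r′x≡c)) r′x≤i)
  ... | no r′x≢c  = stop′ (r-direct x<m r′x≢c) r′x≤i
  lift {x} x<m (step i<r′x s) with r′ x ≟ c
  ... | yes r′x≡c = step′ (r-detour r′x≡c) i<m
                          (step′ (trans r-m (sym r′x≡c)) i<r′x (lift (r-< P x<m) s))
  ... | no r′x≢c  = step′ (r-direct x<m r′x≢c) i<r′x (lift (r-< P x<m) s)

search-within : ∀ {r} i t x → 1 ≤ t → iterate r t x ≤ i →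
                ∃ λ j → Σ (Search r i x j) λ s → depth s ≤ t
search-within {r} i (suc t) x _ rᵗx≤i with r x ≤? i
... | yes rx≤i = r x , stop rx≤i , s≤s z≤n
search-within {r} i (suc zero)    x _ rx≤i | no rx≰i = ⊥-elim (rx≰i rx≤i)
search-within {r} i (suc (suc t)) x _ rᵗx≤i | no rx≰i =
  let j , s , depth≤ = search-within i (suc t) (r x) (s≤s z≤n) rᵗx≤i
  in  j , step (≰⇒> rx≰i) s , s≤s depth≤

search-exists : ∀ {N s r} → PermBelow N s r → ∀ {i} → i < N →
                ∃ λ j → Σ (Search r i i j) λ s → depth s ≤ N
search-exists P {i} i<N with t , 1≤t , t≤N , rᵗi≡i ← return-time P i<N
                       with j , s , depth≤t ← search-within i t i 1≤t (≤-reflexive rᵗi≡i) =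
  j , s , ≤-trans depth≤t t≤N

-- Defs.inomFuel, read on ℕ
searchFuel : ℕ → (ℕ → ℕ) → ℕ → ℕ → ℕ
searchFuel zero    r i x = i
searchFuel (suc F) r i x = if r x ≤ᵇ i then r x else searchFuel F r i (r x)

searchFuel-correct : ∀ {r i x j} (s : Search r i x j) F → depth s ≤ F → searchFuel F r i x ≡ j
searchFuel-correct {r} {i} {x} (stop rx≤i) (suc F) _ with r x ≤ᵇ i in eq
... | true  = refl
... | false = ⊥-elim (subst T eq (≤⇒≤ᵇ rx≤i))
searchFuel-correct {r} {i} {x} (step i<rx s) (suc F) (s≤s depth≤F) with r x ≤ᵇ i in eq
... | true  = ⊥-elim (<⇒≱ i<rx (≤ᵇ⇒≤ (r x) i (subst T (sym eq) _)))
... | false = searchFuel-correct s F depth≤F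

search-searchFuel : ∀ {N s r} → PermBelow N s r → ∀ {i} → i < N →
                    Search r i i (searchFuel N r i i)
search-searchFuel {N} P i<N with j , s , depth≤N ← search-exists P i<N =
  subst (Search _ _ _) (sym (searchFuel-correct s N depth≤N)) s

-- s j is the orbit point just before j, hence > i (or the start x ≥ i).
search-≤-s : ∀ {N s r} → PermBelow N s r → ∀ {i x j} → i ≤ x → Search r i x j → i ≤ s j
search-≤-s P {x = x} i≤x (stop _)     = subst (_ ≤_) (sym (s∘r P x)) i≤x
search-≤-s P         _   (step i<rx s) = search-≤-s P (<⇒≤ i<rx) s

weakExceedance-search : ∀ {N s r} → PermBelow N s r → ∀ {j} → j ≤ s j → Search r (s j) (s j) j
weakExceedance-search P {j} j≤sj = stop′ (r∘s P j) j≤sj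

-- (N-1 c(N-1)) ⋯ (0 c(0)), leftmost factor acting first, as in σ = (n fₙ) ⋯ (1 f₁)
fromCode fromCode⁻¹ : (ℕ → ℕ) → ℕ → ℕ → ℕ
fromCode c zero    x = x
fromCode c (suc m) x = fromCode c m (τ m (c m) x)
fromCode⁻¹ c zero    x = x
fromCode⁻¹ c (suc m) x = τ m (c m) (fromCode⁻¹ c m x)

Subexceedant : ℕ → (ℕ → ℕ) → Set
Subexceedant N c = ∀ {i} → i < N → c i ≤ i

subexceedant-pred : ∀ {m c} → Subexceedant (suc m) c → Subexceedant m c
subexceedant-pred sub i<m = sub (m<n⇒m<1+n i<m)

fromCode-perm : ∀ {N c} → Subexceedant N c → PermBelow N (fromCode c N) (fromCode⁻¹ c N)
fromCode-perm {zero} _ = record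
  { s∘r = λ _ → refl ; r∘s = λ _ → refl ; s-fix = λ _ → refl ; r-fix = λ _ → refl }
fromCode-perm {suc m} sub = insert (fromCode-perm (subexceedant-pred sub)) (sub ≤-refl)

fromCode-search : ∀ {N c} → Subexceedant N c → ∀ {i} → i < N → Search (fromCode⁻¹ c N) i i (c i)
fromCode-search {suc m} {c} sub {i} i<1+m with i ≟ m
... | yes refl = stop′ m↦cm (sub i<1+m)
  where
  m↦cm : τ m (c m) (fromCode⁻¹ c m m) ≡ c m
  m↦cm = trans (cong (τ m (c m)) (r-fix (fromCode-perm (subexceedant-pred sub)) ≤-refl))
               (τ-left m (c m))
... | no i≢m   = search-insert (fromCode-perm sub′) (λ _ → refl) i<m i<m (fromCode-search sub′ i<m)
  where
  sub′ = subexceedant-pred sub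
  i<m  = ≤∧≢⇒< (≤-pred i<1+m) i≢m

factorisation : ∀ {N s r c} → PermBelow N s r → (∀ {i} → i < N → Search r i i (c i)) →
                ∀ x → s x ≡ fromCode c N x
factorisation {zero}          P _    x = s-fix P z≤n
factorisation {suc m} {s} {r} {c} P code x = begin
  s x                         ≡⟨ cong s (τ-involutive m (r m) x) ⟨
  s (τ m (r m) (τ m (r m) x)) ≡⟨ factorisation (delete P) code′ (τ m (r m) x) ⟩
  fromCode c m (τ m (r m) x)  ≡⟨ cong (λ c′ → fromCode c m (τ m c′ x)) rm≡cm ⟩
  fromCode c (suc m) x        ∎
  where
  open ≡-Reasoning
  rm≡cm : r m ≡ c m
  rm≡cm = search-unique (stop (≤-pred (r-< P ≤-refl))) (code ≤-refl)
  code′ : ∀ {i} → i < m → Search (τ m (r m) ∘ r) i i (c i)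
  code′ {i} i<m with j , s′ , _ ← search-exists (delete P) i<m =
    subst (Search _ i i) (search-unique lifted (code (m<n⇒m<1+n i<m))) s′
    where lifted = search-insert (delete P) (λ x → sym (τ-involutive m (r m) (r x))) i<m i<m s′

-- Permutations of Fin n

extend : ∀ {n} → (Fin n → Fin n) → ℕ → ℕ
extend {n} f y with y <? n
... | yes y<n = toℕ (f (fromℕ< y<n))
... | no _    = y

extend-toℕ : ∀ {n} (f : Fin n → Fin n) x → extend f (toℕ x) ≡ toℕ (f x)
extend-toℕ {n} f x with toℕ x <? n
... | yes x<n = cong (toℕ ∘ f) (Fin.fromℕ<-toℕ x x<n)
... | no x≮n  = ⊥-elim (x≮n (Fin.toℕ<n x))

extend-fix : ∀ {n} (f : Fin n → Fin n) {y} → n ≤ y → extend f y ≡ y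
extend-fix {n} f {y} n≤y with y <? n
... | yes y<n = ⊥-elim (<⇒≱ y<n n≤y)
... | no _    = refl

extend-fromℕ< : ∀ {n} (f : Fin n → Fin n) {y} (y<n : y < n) → extend f y ≡ toℕ (f (fromℕ< y<n))
extend-fromℕ< f y<n =
  trans (cong (extend f) (sym (Fin.toℕ-fromℕ< y<n))) (extend-toℕ f (fromℕ< y<n))

extend-inverse : ∀ {n} (f g : Fin n → Fin n) → (∀ x → f (g x) ≡ x) →
                 ∀ y → extend f (extend g y) ≡ y
extend-inverse {n} f g f∘g y with y <? n
... | yes y<n = trans (extend-toℕ f _) (trans (cong toℕ (f∘g _)) (Fin.toℕ-fromℕ< y<n))
... | no y≮n  = extend-fix f (≮⇒≥ y≮n)

extend-perm : ∀ {n} (f g : Fin n → Fin n) → (∀ x → f (g x) ≡ x) → (∀ x → g (f x) ≡ x) →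
              PermBelow n (extend f) (extend g)
extend-perm f g f∘g g∘f = record
  { s∘r   = extend-inverse f g f∘g
  ; r∘s   = extend-inverse g f g∘f
  ; s-fix = extend-fix f
  ; r-fix = extend-fix g
  }

injective⇒surjective : ∀ {n} (f : Fin n → Fin n) → (∀ {a b} → f a ≡ f b → a ≡ b) →
                       ∀ y → ∃ λ x → f x ≡ y
injective⇒surjective {suc m} f f-inj y with Fin.any? (λ x → f x Fin.≟ y)
... | yes found = found
... | no ∄x     = ⊥-elim (1+n≰n (Fin.injective⇒≤ punchOut∘f-injective))
  where
  f≢y : ∀ x → y ≢ f x
  f≢y x y≡fx = ∄x (x , sym y≡fx)
  punchOut∘f-injective : ∀ {a b} → Fin.punchOut (f≢y a) ≡ Fin.punchOut (f≢y b) → a ≡ b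
  punchOut∘f-injective eq = f-inj (Fin.punchOut-injective (f≢y _) (f≢y _) eq)

=ᶠ⇒≡ : ∀ {n} {a b : Fin n} → T (a =ᶠ b) → a ≡ b
=ᶠ⇒≡ {a = a} {b} a=b = Fin.toℕ-injective (≡ᵇ⇒≡ (toℕ a) (toℕ b) a=b)

≡⇒=ᶠ : ∀ {n} {a b : Fin n} → a ≡ b → T (a =ᶠ b)
≡⇒=ᶠ {a = a} {b} a≡b = ≡⇒≡ᵇ (toℕ a) (toℕ b) (cong toℕ a≡b)

isPerm⇒injective : ∀ {n} (σ : Vec (Fin n) n) → T (isPerm σ) →
                   ∀ {a b} → lookup σ a ≡ lookup σ b → a ≡ b
isPerm⇒injective σ σ-perm {a} {b} σa≡σb
  with Equivalence.to T-∨ (all-∈⁻ _ (all-∈⁻ _ σ-perm (∈-allFin a)) (∈-allFin b))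
... | inj₁ a=b   = =ᶠ⇒≡ a=b
... | inj₂ σa≠σb = ⊥-elim (subst T (Equivalence.to T-not-≡ σa≠σb) (≡⇒=ᶠ σa≡σb))

injective⇒isPerm : ∀ {n} (σ : Vec (Fin n) n) → (∀ {a b} → lookup σ a ≡ lookup σ b → a ≡ b) →
                   T (isPerm σ)
injective⇒isPerm {n} σ σ-inj =
  all-∈⁺ _ (allFin n) λ {a} _ → all-∈⁺ _ (allFin n) λ {b} _ → distinct a b
  where
  distinct : ∀ a b → T ((a =ᶠ b) ∨ not (lookup σ a =ᶠ lookup σ b))
  distinct a b with T? (lookup σ a =ᶠ lookup σ b)
  ... | yes σa=σb = Equivalence.from T-∨ (inj₁ (≡⇒=ᶠ (σ-inj (=ᶠ⇒≡ σa=σb))))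
  ... | no σa≠σb  = Equivalence.from T-∨ (inj₂ (Equivalence.from T-not-≡ (¬T⇒≡false σa≠σb)))

firstWith-satisfies : ∀ {n} (p : Fin n → Bool) d js → (∃ λ j → j ∈ js × T (p j)) →
                      T (p (firstWith p d js))
firstWith-satisfies p d (j ∷ js) found with p j in pj | found
... | true  | _                = subst T (sym pj) _
... | false | _ , here refl , pk = ⊥-elim (subst T pj pk)
... | false | k , there k∈ , pk  = firstWith-satisfies p d js (k , k∈ , pk)

σ∘σinv : ∀ {n} (σ : Vec (Fin n) n) → T (isPerm σ) → ∀ y → lookup σ (σinv σ y) ≡ y
σ∘σinv {n} σ σ-perm y
  with x , σx≡y ← injective⇒surjective (lookup σ) (isPerm⇒injective σ σ-perm) y =
  =ᶠ⇒≡ (firstWith-satisfies (λ j → lookup σ j =ᶠ y) y (allFin n) (x , ∈-allFin x , ≡⇒=ᶠ σx≡y))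

isPerm⇒permBelow : ∀ {n} (σ : Vec (Fin n) n) → T (isPerm σ) →
                   PermBelow n (extend (lookup σ)) (extend (σinv σ))
isPerm⇒permBelow σ σ-perm = extend-perm (lookup σ) (σinv σ) (σ∘σinv σ σ-perm)
  (λ x → isPerm⇒injective σ σ-perm (σ∘σinv σ σ-perm (lookup σ x)))

inomFuel≡searchFuel : ∀ {n} F (σ : Vec (Fin n) n) i x →
                      toℕ (inomFuel F σ i x) ≡ searchFuel F (extend (σinv σ)) (toℕ i) (toℕ x)
inomFuel≡searchFuel zero    σ i x = refl
inomFuel≡searchFuel (suc F) σ i x rewrite extend-toℕ (σinv σ) x with σinv σ x ≤ᶠ i
... | true  = refl
... | false = inomFuel≡searchFuel F σ i (σinv σ x)

inom-search : ∀ {n} (σ : Vec (Fin n) n) → T (isPerm σ) →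
              ∀ i → Search (extend (σinv σ)) (toℕ i) (toℕ i) (toℕ (inom σ i))
inom-search {n} σ σ-perm i =
  subst (Search _ _ _) (sym (inomFuel≡searchFuel n σ i i))
        (search-searchFuel (isPerm⇒permBelow σ σ-perm) (Fin.toℕ<n i))

-- Inom codes

code : ∀ {n} → Vec (Fin n) n → Vec (Fin n) n
code σ = tabulate (inomCode σ)

isSubexceedant : ∀ {n} → Vec (Fin n) n → Bool
isSubexceedant {n} c = all (λ i → lookup c i ≤ᶠ i) (allFin n)

isSubexceedant⁻ : ∀ {n} (c : Vec (Fin n) n) → T (isSubexceedant c) →
                  ∀ i → toℕ (lookup c i) ≤ toℕ i
isSubexceedant⁻ c c-sub i = ≤ᵇ⇒≤ _ _ (all-∈⁻ _ c-sub (∈-allFin i))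

-- clamped to c(y) ≤ y, so that `decode` below is defined on every vector
codeℕ : ∀ {n} → Vec (Fin n) n → ℕ → ℕ
codeℕ c y = extend (lookup c) y ⊓ y

codeℕ-subexceedant : ∀ {n} (c : Vec (Fin n) n) → Subexceedant n (codeℕ c)
codeℕ-subexceedant c {i} _ = m⊓n≤n (extend (lookup c) i) i

codeℕ-toℕ : ∀ {n} (c : Vec (Fin n) n) i → toℕ (lookup c i) ≤ toℕ i →
            codeℕ c (toℕ i) ≡ toℕ (lookup c i)
codeℕ-toℕ c i ci≤i = trans (cong (_⊓ toℕ i) (extend-toℕ (lookup c) i)) (m≤n⇒m⊓n≡m ci≤i)

decode : ∀ {n} → Vec (Fin n) n → Vec (Fin n) n
decode c = tabulate λ x → fromℕ< (s-< (fromCode-perm (codeℕ-subexceedant c)) (Fin.toℕ<n x))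

lookup-decode : ∀ {n} (c : Vec (Fin n) n) x →
                toℕ (lookup (decode c) x) ≡ fromCode (codeℕ c) n (toℕ x)
lookup-decode c x = trans (cong toℕ (lookup∘tabulate _ x)) (Fin.toℕ-fromℕ< _)

extend-decode : ∀ {n} (c : Vec (Fin n) n) y → extend (lookup (decode c)) y ≡ fromCode (codeℕ c) n y
extend-decode {n} c y with <-≤-connex y n
... | inj₁ y<n = trans (extend-fromℕ< (lookup (decode c)) y<n)
                      (trans (lookup-decode c _) (cong (fromCode (codeℕ c) n) (Fin.toℕ-fromℕ< y<n)))
... | inj₂ n≤y = trans (extend-fix (lookup (decode c)) n≤y)
                       (sym (s-fix (fromCode-perm (codeℕ-subexceedant c)) n≤y))

decode-isPerm : ∀ {n} (c : Vec (Fin n) n) → T (isPerm (decode c))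
decode-isPerm c = injective⇒isPerm (decode c) λ {a} {b} eq → Fin.toℕ-injective
  (s-injective (fromCode-perm (codeℕ-subexceedant c))
    (trans (sym (lookup-decode c a)) (trans (cong toℕ eq) (lookup-decode c b))))

inom-decode : ∀ {n} (c : Vec (Fin n) n) → T (isSubexceedant c) →
              ∀ i → inom (decode c) i ≡ lookup c i
inom-decode {n} c c-sub i = Fin.toℕ-injective (begin
  toℕ (inom (decode c) i) ≡⟨ search-unique (search-cong σinv≗ (inom-search (decode c) (decode-isPerm c) i))
                                           (fromCode-search (codeℕ-subexceedant c) (Fin.toℕ<n i)) ⟩
  codeℕ c (toℕ i)         ≡⟨ codeℕ-toℕ c i (isSubexceedant⁻ c c-sub i) ⟩
  toℕ (lookup c i)        ∎)
  where
  open ≡-Reasoning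
  σinv≗ : ∀ y → extend (σinv (decode c)) y ≡ fromCode⁻¹ (codeℕ c) n y
  σinv≗ = inverse-unique (isPerm⇒permBelow (decode c) (decode-isPerm c))
                         (fromCode-perm (codeℕ-subexceedant c)) (extend-decode c)

code-decode : ∀ {n} (c : Vec (Fin n) n) → T (isSubexceedant c) → code (decode c) ≡ c
code-decode c c-sub = trans (tabulate-cong (inom-decode c c-sub)) (tabulate∘lookup c)

inom-≤ : ∀ {n} (σ : Vec (Fin n) n) → T (isPerm σ) → ∀ i → toℕ (inom σ i) ≤ toℕ i
inom-≤ σ σ-perm i = search-≤ (inom-search σ σ-perm i)

code-isSubexceedant : ∀ {n} (σ : Vec (Fin n) n) → T (isPerm σ) → T (isSubexceedant (code σ))
code-isSubexceedant {n} σ σ-perm = all-∈⁺ _ (allFin n) λ {i} _ →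
  ≤⇒≤ᵇ (subst (_≤ toℕ i) (cong toℕ (sym (lookup∘tabulate (inom σ) i))) (inom-≤ σ σ-perm i))

codeℕ-code : ∀ {n} (σ : Vec (Fin n) n) → T (isPerm σ) →
             ∀ i → codeℕ (code σ) (toℕ i) ≡ toℕ (inom σ i)
codeℕ-code σ σ-perm i = begin
  codeℕ (code σ) (toℕ i)  ≡⟨ codeℕ-toℕ (code σ) i (code-sub i) ⟩
  toℕ (lookup (code σ) i) ≡⟨ cong toℕ (lookup∘tabulate (inom σ) i) ⟩
  toℕ (inom σ i)          ∎
  where
  open ≡-Reasoning
  code-sub = isSubexceedant⁻ (code σ) (code-isSubexceedant σ σ-perm)

decode-code : ∀ {n} (σ : Vec (Fin n) n) → T (isPerm σ) → decode (code σ) ≡ σ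
decode-code {n} σ σ-perm = lookup-extensional λ x → Fin.toℕ-injective (begin
    toℕ (lookup (decode (code σ)) x)    ≡⟨ lookup-decode (code σ) x ⟩
    fromCode (codeℕ (code σ)) n (toℕ x) ≡⟨ factorisation P code-search (toℕ x) ⟨
    extend (lookup σ) (toℕ x)           ≡⟨ extend-toℕ (lookup σ) x ⟩
    toℕ (lookup σ x)                    ∎)
  where
  open ≡-Reasoning
  P = isPerm⇒permBelow σ σ-perm
  code-search : ∀ {i} → i < n → Search (extend (σinv σ)) i i (codeℕ (code σ) i)
  code-search = ∀-Fin⇒∀-< λ i →
    subst (Search _ _ _) (sym (codeℕ-code σ σ-perm i)) (inom-search σ σ-perm i)

inImage : ∀ {n} → Vec (Fin n) n → Fin n → Bool
inImage {n} c v = any (λ i → lookup c i =ᶠ v) (allFin n)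

imageSize : ∀ {n} → Vec (Fin n) n → ℕ
imageSize {n} c = count (inImage c) (allFin n)

inom-weakExceedance : ∀ {n} (σ : Vec (Fin n) n) → T (isPerm σ) →
                      ∀ {j} → toℕ j ≤ toℕ (lookup σ j) → inom σ (lookup σ j) ≡ j
inom-weakExceedance σ σ-perm {j} j≤σj =
  Fin.toℕ-injective (search-unique (inom-search σ σ-perm (lookup σ j)) one-step)
  where
  σj≡ = extend-toℕ (lookup σ) j
  one-step : Search (extend (σinv σ)) (toℕ (lookup σ j)) (toℕ (lookup σ j)) (toℕ j)
  one-step = subst (λ y → Search _ y y (toℕ j)) σj≡
    (weakExceedance-search (isPerm⇒permBelow σ σ-perm) (subst (toℕ j ≤_) (sym σj≡) j≤σj))

inom-isWeakExceedance : ∀ {n} (σ : Vec (Fin n) n) → T (isPerm σ) →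
                        ∀ i → toℕ (inom σ i) ≤ toℕ (lookup σ (inom σ i))
inom-isWeakExceedance σ σ-perm i = ≤-trans (inom-≤ σ σ-perm i)
  (subst (toℕ i ≤_) (extend-toℕ (lookup σ) (inom σ i))
         (search-≤-s (isPerm⇒permBelow σ σ-perm) ≤-refl (inom-search σ σ-perm i)))

wex≡imageSize : ∀ {n} (σ : Vec (Fin n) n) → T (isPerm σ) → wex σ ≡ imageSize (code σ)
wex≡imageSize {n} σ σ-perm = count-cong _ _ exceedance⇒image image⇒exceedance (allFin n)
  where
  lookup-code : ∀ i → lookup (code σ) i ≡ inom σ i
  lookup-code = lookup∘tabulate (inom σ)
  exceedance⇒image : ∀ j → T (j ≤ᶠ lookup σ j) → T (inImage (code σ) j)
  exceedance⇒image j j≤σj = any-∈⁺ _ (∈-allFin (lookup σ j))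
    (≡⇒=ᶠ (trans (lookup-code _) (inom-weakExceedance σ σ-perm (≤ᵇ⇒≤ _ _ j≤σj))))
  image⇒exceedance : ∀ j → T (inImage (code σ) j) → T (j ≤ᶠ lookup σ j)
  image⇒exceedance j j∈img with i , _ , ci=j ← any-∈⁻ _ (allFin n) j∈img =
    subst (λ j → T (j ≤ᶠ lookup σ j)) (trans (sym (lookup-code i)) (=ᶠ⇒≡ ci=j))
          (≤⇒≤ᵇ (inom-isWeakExceedance σ σ-perm i))

hasIntervalPrefixes : ∀ {n} → (Fin n → Fin n) → Bool
hasIntervalPrefixes {n} f = all (λ i → isInterval (prefixSet f i)) (allFin n)

hasIntervalPrefixes-cong : ∀ {n} {f g : Fin n → Fin n} → (∀ i → f i ≡ g i) →
                           hasIntervalPrefixes f ≡ hasIntervalPrefixes g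
hasIntervalPrefixes-cong {n} f≗g = cong and (map-cong prefixes≡ (allFin n))
  where
  prefixes≡ : ∀ i → isInterval (prefixSet _ i) ≡ isInterval (prefixSet _ i)
  prefixes≡ i = cong isInterval (map-cong f≗g (filterᵇ (_≤ᶠ i) (allFin n)))

isBell2≡hasIntervalPrefixes : ∀ {n} (σ : Vec (Fin n) n) →
                              isBell2 σ ≡ hasIntervalPrefixes (lookup (code σ))
isBell2≡hasIntervalPrefixes σ = hasIntervalPrefixes-cong (λ i → sym (lookup∘tabulate (inom σ) i))

isBellPerm : ∀ {n} → ℕ → Vec (Fin n) n → Bool
isBellPerm k σ = isPerm σ ∧ isBell2 σ ∧ (wex σ ≡ᵇ k)

isBellCode : ∀ {n} → ℕ → Vec (Fin n) n → Bool
isBellCode k c = isSubexceedant c ∧ hasIntervalPrefixes (lookup c) ∧ (imageSize c ≡ᵇ k)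

isBellPerm≡isBellCode∘code : ∀ {n} k (σ : Vec (Fin n) n) → T (isPerm σ) →
                             isBellPerm k σ ≡ isBellCode k (code σ)
isBellPerm≡isBellCode∘code k σ σ-perm = cong₂ _∧_
  (trans (T⇒≡true σ-perm) (sym (T⇒≡true (code-isSubexceedant σ σ-perm))))
  (cong₂ _∧_ (isBell2≡hasIntervalPrefixes σ) (cong (_≡ᵇ k) (wex≡imageSize σ σ-perm)))
  where
  T⇒≡true : ∀ {b} → T b → b ≡ true
  T⇒≡true = Equivalence.to T-≡

bellPerms≅bellCodes : ∀ {n} k → BijectionBetween (isBellPerm {n} k) (isBellCode k)
bellPerms≅bellCodes k = record
  { to      = code
  ; from    = decode
  ; to-q    = λ {σ} σ-bell → subst T (isBellPerm≡isBellCode∘code k σ (isPerm-of {σ} σ-bell)) σ-bell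
  ; from-p  = λ {c} c-bell → subst T (sym (decode-bell c c-bell)) c-bell
  ; from∘to = λ {σ} σ-bell → decode-code σ (isPerm-of {σ} σ-bell)
  ; to∘from = λ {c} c-bell → code-decode c (subexceedant-of {c} c-bell)
  }
  where
  isPerm-of : ∀ {σ} → T (isBellPerm k σ) → T (isPerm σ)
  isPerm-of {σ} = proj₁ ∘ ∧⁻ {isPerm σ}
  subexceedant-of : ∀ {c} → T (isBellCode k c) → T (isSubexceedant c)
  subexceedant-of {c} = proj₁ ∘ ∧⁻ {isSubexceedant c}
  decode-bell : ∀ c → T (isBellCode k c) → isBellPerm k (decode c) ≡ isBellCode k c
  decode-bell c c-bell = trans (isBellPerm≡isBellCode∘code k (decode c) (decode-isPerm c))
                               (cong (isBellCode k) (code-decode c (subexceedant-of {c} c-bell)))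

vectors-enumeration : ∀ n → IsEnumeration (allVecs (allFin n) n)
vectors-enumeration n = allVecs-enumeration (Unique.allFin⁺ n , ∈-allFin) n

bellCount2≡countBellCodes : ∀ n k → bellCount2 n k ≡ count (isBellCode k) (allVecs (allFin n) n)
bellCount2≡countBellCodes n k =
  count-bijection (vectors-enumeration n) (vectors-enumeration n) (bellPerms≅bellCodes k)

-- Bell codes and set partitions

∈-prefixSet⁺ : ∀ {n} (f : Fin n → Fin n) {i y} → toℕ y ≤ toℕ i → f y ∈ prefixSet f i
∈-prefixSet⁺ f {y = y} y≤i = ∈-map⁺ f (∈-filterᵇ⁺ _ (∈-allFin y) (≤⇒≤ᵇ y≤i))

∈-prefixSet⁻ : ∀ {n} (f : Fin n → Fin n) i {v} → v ∈ prefixSet f i → ∃ λ y → toℕ y ≤ toℕ i × v ≡ f y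
∈-prefixSet⁻ {n} f i v∈ with y , y∈ , v≡fy ← ∈-map⁻ f v∈ =
  y , ≤ᵇ⇒≤ _ _ (proj₂ (∈-filterᵇ⁻ _ (allFin n) y∈)) , v≡fy

PrefixImagesDownClosed : ∀ {n} → (Fin n → Fin n) → Set
PrefixImagesDownClosed f = ∀ i v → toℕ v ≤ toℕ (f i) → ∃ λ y → toℕ y ≤ toℕ i × f y ≡ v

-- The intervals {f 0, …, f i} all start at f 0 = 0, so they are initial segments.
intervalPrefixes⇒downClosed : ∀ {n} (c : Vec (Fin n) n) → T (isSubexceedant c) →
                              T (hasIntervalPrefixes (lookup c)) → PrefixImagesDownClosed (lookup c)
intervalPrefixes⇒downClosed {suc n} c c-sub c-int i v v≤ci = taken
  where
  S = prefixSet (lookup c) i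
  S-interval = proj₂ (∧⁻ {any (λ _ → true) S} (all-∈⁻ _ c-int (∈-allFin i)))
  v-convex = all-∈⁻ _ S-interval (∈-allFin v)
  c0≡0 : toℕ (lookup c Fin.zero) ≡ 0
  c0≡0 = n≤0⇒n≡0 (isSubexceedant⁻ c c-sub Fin.zero)
  some≤v : T (any (_≤ᶠ v) S)
  some≤v = any-∈⁺ _ (∈-prefixSet⁺ (lookup c) z≤n) (≤⇒≤ᵇ (subst (_≤ toℕ v) (sym c0≡0) z≤n))
  some≥v : T (any (v ≤ᶠ_) S)
  some≥v = any-∈⁺ _ (∈-prefixSet⁺ (lookup c) ≤-refl) (≤⇒≤ᵇ v≤ci)
  taken : ∃ λ y → toℕ y ≤ toℕ i × lookup c y ≡ v
  taken with a , a∈ , a=v ← any-∈⁻ _ S (T-implication⁻ some≤v some≥v v-convex)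
        with y , y≤i , refl ← ∈-prefixSet⁻ (lookup c) i a∈ = y , y≤i , =ᶠ⇒≡ a=v

downClosed⇒intervalPrefixes : ∀ {n} (f : Fin n → Fin n) → PrefixImagesDownClosed f →
                              T (hasIntervalPrefixes f)
downClosed⇒intervalPrefixes {n} f f-dc = all-∈⁺ _ (allFin n) λ {i} _ →
  ∧⁺ (any-∈⁺ _ (∈-prefixSet⁺ f {i} ≤-refl) _)
     (all-∈⁺ _ (allFin n) λ {v} _ → T-implication⁺ λ _ some≥v → convex i v some≥v)
  where
  convex : ∀ i v → T (any (v ≤ᶠ_) (prefixSet f i)) → T (any (_=ᶠ v) (prefixSet f i))
  convex i v some≥v with b , b∈ , v≤b ← any-∈⁻ _ _ some≥v
                    with y , y≤i , refl ← ∈-prefixSet⁻ f i b∈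
                    with y′ , y′≤y , fy′≡v ← f-dc y v (≤ᵇ⇒≤ _ _ v≤b) =
    any-∈⁺ _ (∈-prefixSet⁺ f (≤-trans y′≤y y≤i)) (≡⇒=ᶠ fy′≡v)

inImage-downClosed : ∀ {n} (c : Vec (Fin n) n) → PrefixImagesDownClosed (lookup c) →
                     DownClosed (inImage c)
inImage-downClosed {n} c c-dc {v} {w} w≤v v∈img
  with i , _ , ci=v ← any-∈⁻ _ (allFin n) v∈img
  with y , _ , cy≡w ← c-dc i w (subst (λ u → toℕ w ≤ toℕ u) (sym (=ᶠ⇒≡ ci=v)) w≤v) =
  any-∈⁺ _ (∈-allFin y) (≡⇒=ᶠ cy≡w)

minElem-≤ : ∀ {n} (B : Vec Bool n) x → T (lookup B x) → minElem B ≤ toℕ x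
minElem-≤ (true  ∷ B) x           _  = z≤n
minElem-≤ (false ∷ B) (Fin.suc x) Bx = s≤s (minElem-≤ B x Bx)

minElem-∈ : ∀ {n} (B : Vec Bool n) x → T (lookup B x) → ∃ λ y → toℕ y ≡ minElem B × T (lookup B y)
minElem-∈ (true  ∷ B) x           _  = Fin.zero , refl , _
minElem-∈ (false ∷ B) (Fin.suc x) Bx with y , y≡min , By ← minElem-∈ B x Bx =
  Fin.suc y , cong suc y≡min , By

Increasing : ∀ {k} → (Fin k → ℕ) → Set
Increasing g = ∀ {j j′} → toℕ j < toℕ j′ → g j < g j′

strictlyIncreasing⁻ : ∀ {k} (g : Fin k → ℕ) → T (strictlyIncreasing (List.tabulate g)) →
                      Increasing g
strictlyIncreasing⁻ {suc zero}    g _   {Fin.zero} {Fin.zero} ()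
strictlyIncreasing⁻ {suc (suc k)} g inc = pairs
  where
  g₀<g₁ : g Fin.zero < g (Fin.suc Fin.zero)
  g₀<g₁ = <ᵇ⇒< _ _ (proj₁ (∧⁻ {g Fin.zero <ᵇ g (Fin.suc Fin.zero)} inc))
  tail : Increasing (g ∘ Fin.suc)
  tail = strictlyIncreasing⁻ (g ∘ Fin.suc) (proj₂ (∧⁻ {g Fin.zero <ᵇ g (Fin.suc Fin.zero)} inc))
  pairs : Increasing g
  pairs {Fin.zero}  {Fin.suc Fin.zero}     _          = g₀<g₁
  pairs {Fin.zero}  {Fin.suc (Fin.suc j′)} _          = <-trans g₀<g₁ (tail {Fin.zero} {Fin.suc j′} z<s)
  pairs {Fin.suc j} {Fin.suc j′}           (s≤s j<j′) = tail j<j′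

strictlyIncreasing⁺ : ∀ {k} (g : Fin k → ℕ) → Increasing g →
                      T (strictlyIncreasing (List.tabulate g))
strictlyIncreasing⁺ {zero}        g inc = _
strictlyIncreasing⁺ {suc zero}    g inc = _
strictlyIncreasing⁺ {suc (suc k)} g inc =
  ∧⁺ (<⇒<ᵇ (inc {Fin.zero} {Fin.suc Fin.zero} z<s)) (strictlyIncreasing⁺ (g ∘ Fin.suc) (inc ∘ s≤s))

increasing⇒monotone : ∀ {k} (g : Fin k → ℕ) → Increasing g → ∀ {j j′} → toℕ j ≤ toℕ j′ → g j ≤ g j′
increasing⇒monotone g inc j≤j′ with m≤n⇒m<n∨m≡n j≤j′
... | inj₁ j<j′ = <⇒≤ (inc j<j′)
... | inj₂ j≡j′ = ≤-reflexive (cong g (Fin.toℕ-injective j≡j′))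

increasing⇒index≤ : ∀ {k} (g : Fin k → ℕ) → Increasing g → ∀ j → toℕ j ≤ g j
increasing⇒index≤ {k} g inc j = below (toℕ j) j ≤-refl
  where
  below : ∀ m j → m ≤ toℕ j → m ≤ g j
  below zero    j _   = z≤n
  below (suc m) j m<j =
    ≤-<-trans (below m j′ (≤-reflexive (sym j′≡m))) (inc (subst (_< toℕ j) (sym j′≡m) m<j))
    where
    j′   = fromℕ< (<-trans m<j (Fin.toℕ<n j))
    j′≡m = Fin.toℕ-fromℕ< (<-trans m<j (Fin.toℕ<n j))

inBlock : ∀ {n k} → Vec (Vec Bool n) k → Fin k → Fin n → Bool
inBlock P j x = lookup (lookup P j) x

record IsPartition {n k} (P : Vec (Vec Bool n) k) : Set where
  field
    nonempty          : ∀ j → ∃ λ x → T (inBlock P j x)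
    block             : Fin n → Fin k
    ∈-block           : ∀ x → T (inBlock P (block x) x)
    block-unique      : ∀ {x j} → T (inBlock P j x) → j ≡ block x
    minima-increasing : Increasing (minElem ∘ lookup P)

count-blocks : ∀ {n k} (P : Vec (Vec Bool n) k) x →
               count (λ B → lookup B x) (toList P) ≡ count (λ j → inBlock P j x) (allFin k)
count-blocks P x =
  trans (cong (count (λ B → lookup B x)) (toList≡tabulate P)) (count-tabulate _ (lookup P))

minima≡tabulate : ∀ {n k} (P : Vec (Vec Bool n) k) →
                  map minElem (toList P) ≡ List.tabulate (minElem ∘ lookup P)
minima≡tabulate P = trans (cong (map minElem) (toList≡tabulate P)) (map-tabulate (lookup P) minElem)

isSetPartition⇒IsPartition : ∀ {n k} (P : Vec (Vec Bool n) k) → T (isSetPartition P) → IsPartition P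
isSetPartition⇒IsPartition {n} {k} P P-part = record
  { nonempty          = nonempty
  ; block             = λ x → proj₁ (exactlyOne x)
  ; ∈-block           = λ x → proj₁ (proj₂ (proj₂ (exactlyOne x)))
  ; block-unique      = λ {x} x∈j → proj₂ (proj₂ (proj₂ (exactlyOne x))) (∈-allFin _) x∈j
  ; minima-increasing = strictlyIncreasing⁻ (minElem ∘ lookup P)
                          (subst (T ∘ strictlyIncreasing) (minima≡tabulate P) increasing)
  }
  where
  allNonempty = proj₁ (∧⁻ {all nonemptyB (toList P)} P-part)
  rest        = proj₂ (∧⁻ {all nonemptyB (toList P)} P-part)
  covering    = proj₁ (∧⁻ {all (λ x → count (λ B → lookup B x) (toList P) ≡ᵇ 1) (allFin n)} rest)
  increasing  = proj₂ (∧⁻ {all (λ x → count (λ B → lookup B x) (toList P) ≡ᵇ 1) (allFin n)} rest)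

  nonempty : ∀ j → ∃ λ x → T (inBlock P j x)
  nonempty j
    with x , _ , x∈j ← any-∈⁻ _ (allFin n) (all-∈⁻ nonemptyB allNonempty
                         (subst (lookup P j ∈_) (sym (toList≡tabulate P)) (∈-tabulate⁺ j))) = x , x∈j

  exactlyOne : ∀ x → ∃ λ j → j ∈ allFin k × T (inBlock P j x) ×
                              (∀ {j′} → j′ ∈ allFin k → T (inBlock P j′ x) → j′ ≡ j)
  exactlyOne x = count≡1⇒∃! _ (allFin k)
    (trans (sym (count-blocks P x)) (≡ᵇ⇒≡ _ 1 (all-∈⁻ _ covering (∈-allFin x))))

IsPartition⇒isSetPartition : ∀ {n k} (P : Vec (Vec Bool n) k) → IsPartition P → T (isSetPartition P)
IsPartition⇒isSetPartition {n} {k} P P-part =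
  ∧⁺ (all-∈⁺ nonemptyB (toList P) nonempty-∈)
     (∧⁺ (all-∈⁺ _ (allFin n) λ {x} _ → ≡⇒≡ᵇ _ 1 (exactlyOne x))
         (subst (T ∘ strictlyIncreasing) (sym (minima≡tabulate P))
                (strictlyIncreasing⁺ (minElem ∘ lookup P) minima-increasing)))
  where
  open IsPartition P-part
  nonempty-∈ : ∀ {B} → B ∈ toList P → T (nonemptyB B)
  nonempty-∈ B∈P with j , refl ← ∈-tabulate⁻ (subst (_ ∈_) (toList≡tabulate P) B∈P)
    = any-∈⁺ _ (∈-allFin (proj₁ (nonempty j))) (proj₂ (nonempty j))
  exactlyOne : ∀ x → count (λ B → lookup B x) (toList P) ≡ 1
  exactlyOne x = trans (count-blocks P x)
    (∃!⇒count≡1 _ (Unique.allFin⁺ k) (∈-allFin (block x)) (∈-block x) (λ _ → block-unique))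

blocksOf : ∀ {n} k → Vec (Fin n) n → Vec (Vec Bool n) k
blocksOf k c = tabulate λ j → tabulate λ x → toℕ (lookup c x) ≡ᵇ toℕ j

inBlock-blocksOf : ∀ {n k} (c : Vec (Fin n) n) (j : Fin k) x →
                   inBlock (blocksOf k c) j x ≡ (toℕ (lookup c x) ≡ᵇ toℕ j)
inBlock-blocksOf c j x = trans (cong (λ B → lookup B x) (lookup∘tabulate _ j)) (lookup∘tabulate _ x)

blockIndex : ∀ {n k} → Vec (Vec Bool n) k → Fin n → ℕ
blockIndex P x with Fin.any? (λ j → T? (inBlock P j x))
... | yes (j , _) = toℕ j
... | no _        = 0

blockIndex-unique : ∀ {n k} (P : Vec (Vec Bool n) k) {x j} → T (inBlock P j x) →
                    (∀ {j′} → T (inBlock P j′ x) → j′ ≡ j) → blockIndex P x ≡ toℕ j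
blockIndex-unique P {x} x∈j unique with Fin.any? (λ j → T? (inBlock P j x))
... | yes (j′ , x∈j′) = cong toℕ (unique x∈j′)
... | no ∄j           = ⊥-elim (∄j (_ , x∈j))

-- clamped to the subexceedant range, so that it is defined for every P
blockCode : ∀ {n k} → Vec (Vec Bool n) k → Vec (Fin n) n
blockCode P = tabulate λ x → fromℕ< (≤-<-trans (m⊓n≤n (blockIndex P x) (toℕ x)) (Fin.toℕ<n x))

toℕ-blockCode : ∀ {n k} (P : Vec (Vec Bool n) k) {x j} → T (inBlock P j x) →
                (∀ {j′} → T (inBlock P j′ x) → j′ ≡ j) → toℕ j ≤ toℕ x →
                toℕ (lookup (blockCode P) x) ≡ toℕ j
toℕ-blockCode P {x} {j} x∈j unique j≤x = begin
  toℕ (lookup (blockCode P) x) ≡⟨ cong toℕ (lookup∘tabulate _ x) ⟩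
  toℕ (fromℕ< _)               ≡⟨ Fin.toℕ-fromℕ< _ ⟩
  blockIndex P x ⊓ toℕ x       ≡⟨ cong (_⊓ toℕ x) (blockIndex-unique P x∈j unique) ⟩
  toℕ j ⊓ toℕ x                ≡⟨ m≤n⇒m⊓n≡m j≤x ⟩
  toℕ j                        ∎
  where open ≡-Reasoning

module FromPartition {n k} (P : Vec (Vec Bool n) k) (P-part : IsPartition P) where
  open IsPartition P-part

  -- block j has minimum ≥ j, since the minima increase
  block≤ : ∀ x → toℕ (block x) ≤ toℕ x
  block≤ x = ≤-trans (increasing⇒index≤ (minElem ∘ lookup P) minima-increasing (block x))
                     (minElem-≤ (lookup P (block x)) x (∈-block x))

  toℕ-code : ∀ x → toℕ (lookup (blockCode P) x) ≡ toℕ (block x)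
  toℕ-code x = toℕ-blockCode P (∈-block x) block-unique (block≤ x)

  code-subexceedant : T (isSubexceedant (blockCode P))
  code-subexceedant = all-∈⁺ _ (allFin n) λ {x} _ →
    ≤⇒≤ᵇ (subst (_≤ toℕ x) (sym (toℕ-code x)) (block≤ x))

  -- the least element y of block v ≤ block i satisfies y ≤ min (block i) ≤ i
  code-downClosed : PrefixImagesDownClosed (lookup (blockCode P))
  code-downClosed i v v≤ci = least (minElem-∈ (lookup P V) _ (proj₂ (nonempty V)))
    where
    v≤bi = subst (toℕ v ≤_) (toℕ-code i) v≤ci
    v<k  = ≤-<-trans v≤bi (Fin.toℕ<n (block i))
    V    = fromℕ< v<k
    V≡v  = Fin.toℕ-fromℕ< v<k
    minV≤i : minElem (lookup P V) ≤ toℕ i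
    minV≤i = begin
      minElem (lookup P V)          ≤⟨ increasing⇒monotone (minElem ∘ lookup P) minima-increasing
                                                           (subst (_≤ toℕ (block i)) (sym V≡v) v≤bi) ⟩
      minElem (lookup P (block i))  ≤⟨ minElem-≤ (lookup P (block i)) i (∈-block i) ⟩
      toℕ i                         ∎
      where open ≤-Reasoning
    least : (∃ λ y → toℕ y ≡ minElem (lookup P V) × T (inBlock P V y)) →
            ∃ λ y → toℕ y ≤ toℕ i × lookup (blockCode P) y ≡ v
    least (y , y≡min , y∈V) =
      y , subst (_≤ toℕ i) (sym y≡min) minV≤i ,
      Fin.toℕ-injective (trans (toℕ-code y) (trans (cong toℕ (sym (block-unique y∈V))) V≡v))

  k≤n : k ≤ n
  k≤n = Fin.injective⇒≤ {f = proj₁ ∘ nonempty} λ {j} {j′} eq →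
    trans (block-unique (proj₂ (nonempty j)))
          (sym (block-unique (subst (T ∘ inBlock P j′) (sym eq) (proj₂ (nonempty j′)))))

  inImage-code : ∀ v → T (inImage (blockCode P) v) → T (toℕ v <ᵇ k)
  inImage-code v v∈img with x , _ , cx=v ← any-∈⁻ _ (allFin n) v∈img =
    <⇒<ᵇ (subst (_< k) (trans (sym (toℕ-code x)) (cong toℕ (=ᶠ⇒≡ cx=v))) (Fin.toℕ<n (block x)))

  code-inImage : ∀ v → T (toℕ v <ᵇ k) → T (inImage (blockCode P) v)
  code-inImage v v<k = any-∈⁺ _ (∈-allFin x) (≡⇒=ᶠ (Fin.toℕ-injective
    (trans (toℕ-code x) (trans (cong toℕ (sym (block-unique x∈V))) (Fin.toℕ-fromℕ< v<k′)))))
    where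
    v<k′ = <ᵇ⇒< _ _ v<k
    V    = fromℕ< v<k′
    x    = proj₁ (nonempty V)
    x∈V  = proj₂ (nonempty V)

  code-isBellCode : T (isBellCode k (blockCode P))
  code-isBellCode = ∧⁺ code-subexceedant (∧⁺ (downClosed⇒intervalPrefixes _ code-downClosed)
    (≡⇒≡ᵇ _ k (trans (count-cong _ _ inImage-code code-inImage (allFin n))
                     (count-initialSegment n k k≤n))))

  blocksOf-code : blocksOf k (blockCode P) ≡ P
  blocksOf-code = lookup-extensional λ j → trans (lookup∘tabulate _ j) (lookup-extensional λ x →
    trans (lookup∘tabulate _ x) (T-injective (in-P j x) (in-blocksOf j x)))
    where
    in-P : ∀ j x → T (toℕ (lookup (blockCode P) x) ≡ᵇ toℕ j) → T (inBlock P j x)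
    in-P j x cx≡j = subst (λ j′ → T (inBlock P j′ x))
      (Fin.toℕ-injective (trans (sym (toℕ-code x)) (≡ᵇ⇒≡ _ _ cx≡j))) (∈-block x)
    in-blocksOf : ∀ j x → T (inBlock P j x) → T (toℕ (lookup (blockCode P) x) ≡ᵇ toℕ j)
    in-blocksOf j x x∈j = ≡⇒≡ᵇ _ _ (trans (toℕ-code x) (cong toℕ (sym (block-unique x∈j))))

module FromBellCode {n} k (c : Vec (Fin n) n) (c-bell : T (isBellCode k c)) where
  c-sub : T (isSubexceedant c)
  c-sub = proj₁ (∧⁻ {isSubexceedant c} c-bell)

  c-rest : T (hasIntervalPrefixes (lookup c) ∧ (imageSize c ≡ᵇ k))
  c-rest = proj₂ (∧⁻ {isSubexceedant c} c-bell)

  c-dc : PrefixImagesDownClosed (lookup c)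
  c-dc = intervalPrefixes⇒downClosed c c-sub (proj₁ (∧⁻ {hasIntervalPrefixes (lookup c)} c-rest))

  c-size : imageSize c ≡ k
  c-size = ≡ᵇ⇒≡ _ k (proj₂ (∧⁻ {hasIntervalPrefixes (lookup c)} c-rest))

  inImage≡ : ∀ v → inImage c v ≡ (toℕ v <ᵇ k)
  inImage≡ v = trans (downClosed⇒initialSegment (inImage c) (inImage-downClosed c c-dc) v)
                     (cong (toℕ v <ᵇ_) c-size)

  k≤n : k ≤ n
  k≤n = subst (_≤ n) c-size
    (≤-trans (count-≤-length (inImage c) (allFin n)) (≤-reflexive (length-tabulate id)))

  c<k : ∀ x → toℕ (lookup c x) < k
  c<k x = <ᵇ⇒< _ _ (subst T (inImage≡ (lookup c x))
                           (any-∈⁺ _ (∈-allFin x) (≡⇒=ᶠ {a = lookup c x} refl)))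

  toℕ-inject : ∀ j → toℕ (Fin.inject≤ j k≤n) ≡ toℕ j
  toℕ-inject j = Fin.toℕ-inject≤ j k≤n

  inImage-inject : ∀ j → T (inImage c (Fin.inject≤ j k≤n))
  inImage-inject j = subst T (sym (inImage≡ _)) (<⇒<ᵇ (subst (_< k) (sym (toℕ-inject j)) (Fin.toℕ<n j)))

  hit : ∀ (j : Fin k) → ∃ λ x → toℕ (lookup c x) ≡ toℕ j
  hit j with x , _ , cx=j ← any-∈⁻ _ (allFin n) (inImage-inject j) =
    x , trans (cong toℕ (=ᶠ⇒≡ cx=j)) (toℕ-inject j)

  ∈-blocks⁻ : ∀ {j x} → T (inBlock (blocksOf k c) j x) → toℕ (lookup c x) ≡ toℕ j
  ∈-blocks⁻ {j} {x} x∈j = ≡ᵇ⇒≡ _ _ (subst T (inBlock-blocksOf c j x) x∈j)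

  ∈-blocks⁺ : ∀ {j x} → toℕ (lookup c x) ≡ toℕ j → T (inBlock (blocksOf k c) j x)
  ∈-blocks⁺ {j} {x} cx≡j = subst T (sym (inBlock-blocksOf c j x)) (≡⇒≡ᵇ _ _ cx≡j)

  earlier-value : ∀ {j j′ : Fin k} → toℕ j < toℕ j′ → ∀ {y′} → toℕ (lookup c y′) ≡ toℕ j′ →
                  ∃ λ y → toℕ y < toℕ y′ × toℕ (lookup c y) ≡ toℕ j
  earlier-value {j} {j′} j<j′ {y′} cy′≡j′
    with y , y≤y′ , cy≡j ← c-dc y′ (Fin.inject≤ j k≤n)
                                (subst₂ _≤_ (sym (toℕ-inject j)) (sym cy′≡j′) (<⇒≤ j<j′)) =
    y , ≤∧≢⇒< y≤y′ y≢y′ , toℕ-cy≡j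
    where
    toℕ-cy≡j = trans (cong toℕ cy≡j) (toℕ-inject j)
    y≢y′ : toℕ y ≢ toℕ y′
    y≢y′ y≡y′ with refl ← Fin.toℕ-injective y≡y′ = <⇒≢ j<j′ (trans (sym toℕ-cy≡j) cy′≡j′)

  minima-increasing : Increasing (minElem ∘ lookup (blocksOf k c))
  minima-increasing {j} {j′} j<j′
    with y′ , y′≡min , y′∈j′ ← minElem-∈ _ (proj₁ (hit j′)) (∈-blocks⁺ (proj₂ (hit j′)))
    with y , y<y′ , cy≡j ← earlier-value j<j′ (∈-blocks⁻ y′∈j′) =
    ≤-<-trans (minElem-≤ _ y (∈-blocks⁺ cy≡j)) (subst (toℕ y <_) y′≡min y<y′)

  blocks-partition : IsPartition (blocksOf k c)
  blocks-partition = record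
    { nonempty          = λ j → proj₁ (hit j) , ∈-blocks⁺ (proj₂ (hit j))
    ; block             = λ x → fromℕ< (c<k x)
    ; ∈-block           = λ x → ∈-blocks⁺ (sym (Fin.toℕ-fromℕ< (c<k x)))
    ; block-unique      = λ {x} x∈j →
                            Fin.toℕ-injective (trans (sym (∈-blocks⁻ x∈j)) (sym (Fin.toℕ-fromℕ< (c<k x))))
    ; minima-increasing = minima-increasing
    }

  blockCode-blocks : blockCode (blocksOf k c) ≡ c
  blockCode-blocks = lookup-extensional λ x → Fin.toℕ-injective
    (trans (FromPartition.toℕ-code (blocksOf k c) blocks-partition x) (Fin.toℕ-fromℕ< (c<k x)))

partitions≅bellCodes : ∀ {n} k → BijectionBetween (isSetPartition {n} {k}) (isBellCode k)
partitions≅bellCodes k = record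
  { to      = blockCode
  ; from    = blocksOf k
  ; to-q    = λ {P} P-part → FromPartition.code-isBellCode P (isSetPartition⇒IsPartition P P-part)
  ; from-p  = λ {c} c-bell → IsPartition⇒isSetPartition _ (FromBellCode.blocks-partition k c c-bell)
  ; from∘to = λ {P} P-part → FromPartition.blocksOf-code P (isSetPartition⇒IsPartition P P-part)
  ; to∘from = λ {c} c-bell → FromBellCode.blockCode-blocks k c c-bell
  }

subsets-enumeration : ∀ n k → IsEnumeration (allVecs (allSubsets n) k)
subsets-enumeration n = allVecs-enumeration (allVecs-enumeration bools n)
  where
  bools : IsEnumeration (true ∷ false ∷ [])
  bools = ((λ ()) All.∷ All.[]) ∷ All.[] ∷ [] , λ { true → here refl ; false → there (here refl) }

stirling2≡countBellCodes : ∀ n k → stirling2 n k ≡ count (isBellCode k) (allVecs (allFin n) n)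
stirling2≡countBellCodes n k =
  count-bijection (subsets-enumeration n k) (vectors-enumeration n) (partitions≅bellCodes k)

mainTheorem3 : (n k : ℕ) → 1 ≤ n → bellCount2 n k ≡ stirling2 n k
mainTheorem3 n k _ = trans (bellCount2≡countBellCodes n k) (sym (stirling2≡countBellCodes n k))
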